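{- Let $H$ be an $m$-edge coloured graph and let $\Gamma\subseteq S_m$ be a group acting transitively on $\{1,\dots,m\}$. For every $\tau\in[\Gamma,\Gamma]$ and every edge $uw$ of $H$ of colour $i$, there is a finite sequence $\Sigma$ of switches (with respect to elements of $\Gamma$) such that in $H^\Sigma$ the edge $uw$ has colour $\tau(i)$ and every other edge has the same colour in $H^\Sigma$ as in $H$.
   Context: An $m$-edge coloured graph is a finite simple graph with each edge assigned a colour in $\{1,\dots,m\}$. Switching at a vertex $v$ with respect to $\pi\in\Gamma$ replaces the colour $c$ of every edge incident with $v$ by $\pi(c)$; $H^\Sigma$ denotes the result of applying the switches of the sequence $\Sigma$ in order. $[\Gamma,\Gamma]$ is the commutator subgroup of $\Gamma$, generated by all $\pi\phi\pi^{ -1}\phi^{ -1}$ with $\pi,\phi\in\Gamma$. -}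

module Defs where

open import Data.Nat using (ℕ)
open import Data.Fin using (Fin)
open import Data.Fin.Permutation using (Permutation′; _⟨$⟩ʳ_; _∘ₚ_; flip; id)
open import Data.Product using (Σ; _×_; _,_; ∃; ∃-syntax)
open import Data.List using (List; foldl; map)
open import Data.List.Relation.Unary.All using (All)
open import Data.Fin using (_≟_)
open import Relation.Nullary using (yes; no; ¬_)
open import Relation.Binary.PropositionalEquality using (_≡_)
open import Level using (0ℓ; suc)

Perm : ℕ → Set
Perm m = Permutation′ m

-- Composition in the usual functional order: (π · φ)(c) = π (φ c).
_·_ : ∀ {m} → Perm m → Perm m → Perm m
π · φ = φ ∘ₚ π

_⁻¹ : ∀ {m} → Perm m → Perm m
π ⁻¹ = flip π

_≈ₚ_ : ∀ {m} → Perm m → Perm m → Set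
π ≈ₚ φ = ∀ c → π ⟨$⟩ʳ c ≡ φ ⟨$⟩ʳ c

record Subgroup (m : ℕ) : Set₁ where
  field
    _∈Γ_    : Perm m → Set
    ∈-resp  : ∀ {π φ} → π ≈ₚ φ → _∈Γ_ π → _∈Γ_ φ
    ∈-id    : _∈Γ_ id
    ∈-·     : ∀ {π φ} → _∈Γ_ π → _∈Γ_ φ → _∈Γ_ (π · φ)
    ∈-⁻¹    : ∀ {π} → _∈Γ_ π → _∈Γ_ (π ⁻¹)

Mem : ∀ {m} → Subgroup m → Perm m → Set
Mem Γ π = Subgroup._∈Γ_ Γ π

Transitive : ∀ {m} → Subgroup m → Set
Transitive {m} Γ = ∀ (i j : Fin m) → ∃[ π ] (Mem Γ π × π ⟨$⟩ʳ i ≡ j)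

data InCommutator {m : ℕ} (Γ : Subgroup m) : Perm m → Set where
  comm  : ∀ {π φ} → Mem Γ π → Mem Γ φ →
          InCommutator Γ (π · (φ · ((π ⁻¹) · (φ ⁻¹))))
  cid   : InCommutator Γ id
  cmul  : ∀ {π φ} → InCommutator Γ π → InCommutator Γ φ → InCommutator Γ (π · φ)
  cinv  : ∀ {π} → InCommutator Γ π → InCommutator Γ (π ⁻¹)
  cresp : ∀ {π φ} → π ≈ₚ φ → InCommutator Γ π → InCommutator Γ φ

-- The colouring is a function on all ordered pairs, symmetric on edges;
-- its values on non-edges are irrelevant.
record ColouredGraph (n m : ℕ) : Set₁ where
  field
    Edge     : Fin n → Fin n → Set
    edge-sym : ∀ {x y} → Edge x y → Edge y x
    irrefl   : ∀ {x} → ¬ Edge x x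
    col      : Fin n → Fin n → Fin m
    col-sym  : ∀ {x y} → Edge x y → col x y ≡ col y x

switchCol : ∀ {n m} → (Fin n → Fin n → Fin m) → Fin n → Perm m →
            Fin n → Fin n → Fin m
switchCol c v π x y with x ≟ v | y ≟ v
... | yes _ | _     = π ⟨$⟩ʳ c x y
... | no _  | yes _ = π ⟨$⟩ʳ c x y
... | no _  | no _  = c x y

Switches : ℕ → ℕ → Set
Switches n m = List (Σ (Fin n) (λ _ → Perm m))

applySwitches : ∀ {n m} → (Fin n → Fin n → Fin m) → Switches n m →
                Fin n → Fin n → Fin m
applySwitches c Σs = foldl (λ d s → switchCol d (Data.Product.proj₁ s) (Data.Product.proj₂ s)) c Σs

-- H^Σ (the graph itself is unchanged; only the colouring changes).
_^^_ : ∀ {n m} → ColouredGraph n m → Switches n m → Fin n → Fin n → Fin m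
H ^^ Σs = applySwitches (ColouredGraph.col H) Σs

SwitchesIn : ∀ {n m} → Subgroup m → Switches n m → Set
SwitchesIn Γ Σs = All (λ s → Mem Γ (Data.Product.proj₂ s)) Σs

-- Switching the two ends u, w of an edge by φ⁻¹ at w, π⁻¹ at u, φ at w, π at u
-- changes the colour of uw by the commutator π φ π⁻¹ φ⁻¹, while every other pair
-- meets at most one of u, w and so sees only a switch followed by its inverse.
-- Concatenating such sequences realises products, so the set of permutations
-- realisable on a single edge contains the whole commutator subgroup.
module Submission where

open import Defs
open import Data.Nat using (ℕ)
open import Data.Fin using (Fin; _≟_)
open import Data.Fin.Permutation using (_⟨$⟩ʳ_; _⟨$⟩ˡ_; inverseˡ; inverseʳ; id)
open import Data.Product using (_×_; ∃-syntax; _,_; proj₁)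
open import Data.Sum using (_⊎_; inj₁; inj₂)
open import Data.List using ([]; _∷_; _++_)
open import Data.List.Properties using (foldl-++)
open import Data.List.Relation.Unary.All using ([]; _∷_)
open import Data.List.Relation.Unary.All.Properties using (++⁺)
open import Relation.Nullary using (¬_; yes; no)
open import Data.Empty using (⊥-elim)
open import Relation.Binary.PropositionalEquality
open ≡-Reasoning

⁻¹-resp-≈ₚ : ∀ {m} {π φ : Perm m} → π ≈ₚ φ → (π ⁻¹) ≈ₚ (φ ⁻¹)
⁻¹-resp-≈ₚ {π = π} {φ} π≈φ c = begin
  π ⟨$⟩ˡ c                           ≡⟨ cong (π ⟨$⟩ˡ_) (sym (inverseʳ φ)) ⟩
  π ⟨$⟩ˡ (φ ⟨$⟩ʳ (φ ⟨$⟩ˡ c))         ≡⟨ cong (π ⟨$⟩ˡ_) (sym (π≈φ _)) ⟩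
  π ⟨$⟩ˡ (π ⟨$⟩ʳ (φ ⟨$⟩ˡ c))         ≡⟨ inverseˡ π ⟩
  φ ⟨$⟩ˡ c                           ∎

-- A simultaneous induction on τ and τ⁻¹, since InCommutator has a constructor
-- for inverses but P is only assumed closed under products.
InCommutator-induction : ∀ {m} {Γ : Subgroup m} (P : Perm m → Set) →
  (∀ {π φ} → π ≈ₚ φ → P π → P φ) →
  P id →
  (∀ {π φ} → P π → P φ → P (π · φ)) →
  (∀ {π φ} → Mem Γ π → Mem Γ φ → P (π · (φ · ((π ⁻¹) · (φ ⁻¹))))) →
  ∀ {τ} → InCommutator Γ τ → P τ
InCommutator-induction {Γ = Γ} P resp P-id P-· P-comm τ∈ = proj₁ (both τ∈)
  where
  both : ∀ {τ} → InCommutator Γ τ → P τ × P (τ ⁻¹)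
  both (comm π∈ φ∈)   = P-comm π∈ φ∈ , P-comm φ∈ π∈
  both cid            = P-id , P-id
  both (cmul {π} {φ} p q) with both p | both q
  ... | Pπ , Pπ⁻¹ | Pφ , Pφ⁻¹ = P-· {π} {φ} Pπ Pφ , P-· {φ ⁻¹} {π ⁻¹} Pφ⁻¹ Pπ⁻¹
  both (cinv p) with both p
  ... | Pπ , Pπ⁻¹ = Pπ⁻¹ , Pπ
  both (cresp {π} {φ} π≈φ p) with both p
  ... | Pπ , Pπ⁻¹ = resp {π} {φ} π≈φ Pπ , resp {π ⁻¹} {φ ⁻¹} (⁻¹-resp-≈ₚ {π = π} {φ} π≈φ) Pπ⁻¹

module _ {n m : ℕ} where

  Colouring : Set
  Colouring = Fin n → Fin n → Fin m

  Incident : Fin n → Fin n → Fin n → Set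
  Incident v x y = x ≡ v ⊎ y ≡ v

  Avoids : Fin n → Fin n → Fin n → Set
  Avoids v x y = ¬ x ≡ v × ¬ y ≡ v

  incident? : ∀ v x y → Incident v x y ⊎ Avoids v x y
  incident? v x y with x ≟ v | y ≟ v
  ... | yes x≡v | _       = inj₁ (inj₁ x≡v)
  ... | no _    | yes y≡v = inj₁ (inj₂ y≡v)
  ... | no x≢v  | no y≢v  = inj₂ (x≢v , y≢v)

  switchCol-incident : ∀ (d : Colouring) v π {x y} → Incident v x y →
    switchCol d v π x y ≡ π ⟨$⟩ʳ d x y
  switchCol-incident d v π {x} {y} x∼v with x ≟ v | y ≟ v | x∼v
  ... | yes _ | _     | _            = refl
  ... | no _  | yes _ | _            = refl
  ... | no x≢v | no _ | inj₁ x≡v     = ⊥-elim (x≢v x≡v)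
  ... | no _  | no y≢v | inj₂ y≡v    = ⊥-elim (y≢v y≡v)

  switchCol-avoids : ∀ (d : Colouring) v π {x y} → Avoids v x y →
    switchCol d v π x y ≡ d x y
  switchCol-avoids d v π {x} {y} (x≢v , y≢v) with x ≟ v | y ≟ v
  ... | yes x≡v | _       = ⊥-elim (x≢v x≡v)
  ... | no _    | yes y≡v = ⊥-elim (y≢v y≡v)
  ... | no _    | no _    = refl

  switchCol-local : ∀ (d e : Colouring) v π x y → d x y ≡ e x y →
    switchCol d v π x y ≡ switchCol e v π x y
  switchCol-local d e v π x y dxy≡exy with incident? v x y
  ... | inj₁ x∼v = begin
    switchCol d v π x y  ≡⟨ switchCol-incident d v π x∼v ⟩
    π ⟨$⟩ʳ d x y         ≡⟨ cong (π ⟨$⟩ʳ_) dxy≡exy ⟩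
    π ⟨$⟩ʳ e x y         ≡⟨ switchCol-incident e v π x∼v ⟨
    switchCol e v π x y  ∎
  ... | inj₂ x≁v = begin
    switchCol d v π x y  ≡⟨ switchCol-avoids d v π x≁v ⟩
    d x y                ≡⟨ dxy≡exy ⟩
    e x y                ≡⟨ switchCol-avoids e v π x≁v ⟨
    switchCol e v π x y  ∎

  switchCol-cancel : ∀ (d : Colouring) v π x y →
    switchCol (switchCol d v (π ⁻¹)) v π x y ≡ d x y
  switchCol-cancel d v π x y with incident? v x y
  ... | inj₁ x∼v = begin
    switchCol (switchCol d v (π ⁻¹)) v π x y  ≡⟨ switchCol-incident _ v π x∼v ⟩
    π ⟨$⟩ʳ switchCol d v (π ⁻¹) x y           ≡⟨ cong (π ⟨$⟩ʳ_) (switchCol-incident d v (π ⁻¹) x∼v) ⟩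
    π ⟨$⟩ʳ (π ⟨$⟩ˡ d x y)                     ≡⟨ inverseʳ π ⟩
    d x y                                     ∎
  ... | inj₂ x≁v = trans (switchCol-avoids _ v π x≁v) (switchCol-avoids d v (π ⁻¹) x≁v)

  applySwitches-++ : ∀ (d : Colouring) Σ₁ Σ₂ →
    applySwitches d (Σ₁ ++ Σ₂) ≡ applySwitches (applySwitches d Σ₁) Σ₂
  applySwitches-++ d = foldl-++ _ d

  avoids-an-end : ∀ {u w x y} → ¬ u ≡ w →
    ¬ (x ≡ u × y ≡ w) → ¬ (x ≡ w × y ≡ u) → Avoids u x y ⊎ Avoids w x y
  avoids-an-end {u} {w} {x} {y} u≢w ≢uw ≢wu with incident? u x y | incident? w x y
  ... | inj₂ x≁u | _        = inj₁ x≁u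
  ... | inj₁ _   | inj₂ x≁w = inj₂ x≁w
  ... | inj₁ (inj₁ x≡u) | inj₁ (inj₁ x≡w) = ⊥-elim (u≢w (trans (sym x≡u) x≡w))
  ... | inj₁ (inj₁ x≡u) | inj₁ (inj₂ y≡w) = ⊥-elim (≢uw (x≡u , y≡w))
  ... | inj₁ (inj₂ y≡u) | inj₁ (inj₁ x≡w) = ⊥-elim (≢wu (x≡w , y≡u))
  ... | inj₁ (inj₂ y≡u) | inj₁ (inj₂ y≡w) = ⊥-elim (u≢w (trans (sym y≡u) y≡w))

  -- Quantifying over all colourings d, not just that of H, is what makes
  -- realisable permutations closed under products.
  EdgeRealisable : Subgroup m → Fin n → Fin n → Perm m → Set
  EdgeRealisable Γ u w τ = ∃[ Σs ] (SwitchesIn Γ Σs ×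
    (∀ (d : Colouring) → applySwitches d Σs u w ≡ τ ⟨$⟩ʳ d u w) ×
    (∀ (d : Colouring) x y → ¬ (x ≡ u × y ≡ w) → ¬ (x ≡ w × y ≡ u) →
       applySwitches d Σs x y ≡ d x y))

  module _ (Γ : Subgroup m) (u w : Fin n) where

    EdgeRealisable-resp : ∀ {π φ} → π ≈ₚ φ →
      EdgeRealisable Γ u w π → EdgeRealisable Γ u w φ
    EdgeRealisable-resp π≈φ (Σs , Σs∈Γ , onEdge , offEdge) =
      Σs , Σs∈Γ , (λ d → trans (onEdge d) (π≈φ _)) , offEdge

    EdgeRealisable-id : EdgeRealisable Γ u w id
    EdgeRealisable-id = [] , [] , (λ _ → refl) , (λ _ _ _ _ _ → refl)

    EdgeRealisable-· : ∀ {π φ} → EdgeRealisable Γ u w π → EdgeRealisable Γ u w φ →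
      EdgeRealisable Γ u w (π · φ)
    EdgeRealisable-· {π} {φ} (Σπ , Σπ∈Γ , onπ , offπ) (Σφ , Σφ∈Γ , onφ , offφ) =
      Σφ ++ Σπ , ++⁺ Σφ∈Γ Σπ∈Γ , onEdge , offEdge
      where
      split : ∀ d x y → applySwitches d (Σφ ++ Σπ) x y ≡ applySwitches (applySwitches d Σφ) Σπ x y
      split d x y = cong (λ e → e x y) (applySwitches-++ d Σφ Σπ)

      onEdge : ∀ d → applySwitches d (Σφ ++ Σπ) u w ≡ (π · φ) ⟨$⟩ʳ d u w
      onEdge d = begin
        applySwitches d (Σφ ++ Σπ) u w             ≡⟨ split d u w ⟩
        applySwitches (applySwitches d Σφ) Σπ u w  ≡⟨ onπ _ ⟩
        π ⟨$⟩ʳ applySwitches d Σφ u w              ≡⟨ cong (π ⟨$⟩ʳ_) (onφ d) ⟩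
        π ⟨$⟩ʳ (φ ⟨$⟩ʳ d u w)                      ∎

      offEdge : ∀ d x y → ¬ (x ≡ u × y ≡ w) → ¬ (x ≡ w × y ≡ u) →
        applySwitches d (Σφ ++ Σπ) x y ≡ d x y
      offEdge d x y ≢uw ≢wu =
        trans (split d x y) (trans (offπ _ x y ≢uw ≢wu) (offφ d x y ≢uw ≢wu))

    EdgeRealisable-commutator : ¬ u ≡ w → ∀ {π φ} → Mem Γ π → Mem Γ φ →
      EdgeRealisable Γ u w (π · (φ · ((π ⁻¹) · (φ ⁻¹))))
    EdgeRealisable-commutator u≢w {π} {φ} π∈Γ φ∈Γ =
      Σs , (∈-⁻¹ φ∈Γ ∷ ∈-⁻¹ π∈Γ ∷ φ∈Γ ∷ π∈Γ ∷ []) , onEdge , offEdge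
      where
      open Subgroup Γ
      Σs = (w , φ ⁻¹) ∷ (u , π ⁻¹) ∷ (w , φ) ∷ (u , π) ∷ []

      at-u : Incident u u w
      at-u = inj₁ refl
      at-w : Incident w u w
      at-w = inj₂ refl

      onEdge : ∀ d → applySwitches d Σs u w ≡ (π · (φ · ((π ⁻¹) · (φ ⁻¹)))) ⟨$⟩ʳ d u w
      onEdge d = begin
        applySwitches d Σs u w
          ≡⟨ switchCol-incident _ u π at-u ⟩
        π ⟨$⟩ʳ switchCol d₂ w φ u w
          ≡⟨ cong (π ⟨$⟩ʳ_) (switchCol-incident _ w φ at-w) ⟩
        π ⟨$⟩ʳ (φ ⟨$⟩ʳ switchCol d₁ u (π ⁻¹) u w)
          ≡⟨ cong (λ c → π ⟨$⟩ʳ (φ ⟨$⟩ʳ c)) (switchCol-incident _ u (π ⁻¹) at-u) ⟩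
        π ⟨$⟩ʳ (φ ⟨$⟩ʳ (π ⟨$⟩ˡ switchCol d w (φ ⁻¹) u w))
          ≡⟨ cong (λ c → π ⟨$⟩ʳ (φ ⟨$⟩ʳ (π ⟨$⟩ˡ c))) (switchCol-incident d w (φ ⁻¹) at-w) ⟩
        π ⟨$⟩ʳ (φ ⟨$⟩ʳ (π ⟨$⟩ˡ (φ ⟨$⟩ˡ d u w)))
          ∎
        where
        d₁ = switchCol d w (φ ⁻¹)
        d₂ = switchCol d₁ u (π ⁻¹)

      offEdge : ∀ d x y → ¬ (x ≡ u × y ≡ w) → ¬ (x ≡ w × y ≡ u) →
        applySwitches d Σs x y ≡ d x y
      offEdge d x y ≢uw ≢wu with avoids-an-end u≢w ≢uw ≢wu
      ... | inj₁ x≁u = begin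
        applySwitches d Σs x y
          ≡⟨ switchCol-avoids _ u π x≁u ⟩
        switchCol (switchCol d₁ u (π ⁻¹)) w φ x y
          ≡⟨ switchCol-local _ _ w φ x y (switchCol-avoids d₁ u (π ⁻¹) x≁u) ⟩
        switchCol (switchCol d w (φ ⁻¹)) w φ x y
          ≡⟨ switchCol-cancel d w φ x y ⟩
        d x y
          ∎
        where d₁ = switchCol d w (φ ⁻¹)
      ... | inj₂ x≁w = begin
        applySwitches d Σs x y
          ≡⟨ switchCol-local _ _ u π x y (switchCol-avoids _ w φ x≁w) ⟩
        switchCol (switchCol d₁ u (π ⁻¹)) u π x y
          ≡⟨ switchCol-cancel d₁ u π x y ⟩
        switchCol d w (φ ⁻¹) x y
          ≡⟨ switchCol-avoids d w (φ ⁻¹) x≁w ⟩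
        d x y
          ∎
        where d₁ = switchCol d w (φ ⁻¹)

    EdgeRealisable-commutatorSubgroup : ¬ u ≡ w → ∀ {τ} → InCommutator Γ τ →
      EdgeRealisable Γ u w τ
    EdgeRealisable-commutatorSubgroup u≢w =
      InCommutator-induction (EdgeRealisable Γ u w)
        (λ {π} {φ} → EdgeRealisable-resp {π} {φ}) EdgeRealisable-id
        (λ {π} {φ} → EdgeRealisable-· {π} {φ}) (EdgeRealisable-commutator u≢w)

lemma3p1 : ∀ {n m : ℕ} (H : ColouredGraph n m) (Γ : Subgroup m) →
    Transitive Γ →
    ∀ (τ : Perm m) → InCommutator Γ τ →
    ∀ (u w : Fin n) → ColouredGraph.Edge H u w →
    ∃[ Σs ] (SwitchesIn Γ Σs ×
      (H ^^ Σs) u w ≡ τ ⟨$⟩ʳ ColouredGraph.col H u w ×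
      (∀ (x y : Fin n) → ColouredGraph.Edge H x y →
        ¬ (x ≡ u × y ≡ w) → ¬ (x ≡ w × y ≡ u) →
        (H ^^ Σs) x y ≡ ColouredGraph.col H x y))
lemma3p1 H Γ _ τ τ∈ u w uw =
  let Σs , Σs∈Γ , onEdge , offEdge = EdgeRealisable-commutatorSubgroup Γ u w u≢w τ∈
  in  Σs , Σs∈Γ , onEdge col , λ x y _ → offEdge col x y
  where
  open ColouredGraph H
  u≢w : ¬ u ≡ w
  u≢w refl = irrefl uw
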